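{- Let $m\ge 3$ and $i\ge 0$ be integers. Let $\mathscr{A}=(A_{n,k})_{n\ge k\ge 0}\in SDR_m$ and $\mathscr{B}=(B_{n,k})_{n\ge k\ge 0}\in SDR_{m+i}$. Then the Hadamard product $\mathscr{A}\circ\mathscr{B}=(A_{n,k}B_{n,k})_{n\ge k\ge 0}$ belongs to $SDR_m$. Moreover, if $A_{n,k}\neq 0$ for all $n\ge k\ge 0$, then the Hadamard inverse $\mathscr{A}^{\circ(-1)}=(A_{n,k}^{ -1})_{n\ge k\ge 0}$ belongs to $SDR_m$.
   Context: All matrices are infinite lower triangular matrices $\mathscr{A}=(A_{n,k})_{n\ge k\ge 0}$ with complex entries; we set $A_{n,k}=0$ whenever $k>n$. For an integer $m\ge 3$, $\mathscr{A}$ is called an SDR-matrix of order $m$ (written $\mathscr{A}\in SDR_m$) if for all integers $n,k\ge 0$, all $2\le p\le m-1$ and all $0\le r\le p-1$, $$\prod_{i=0}^{r}A_{n+i,k+r-i}\prod_{i=0}^{p-r-1}A_{n+p-i,k+r+i+1}=\prod_{i=0}^{r}A_{n+p-i,k+p-r+i}\prod_{i=0}^{p-r-1}A_{n+i,k+p-r-i-1}.$$ -}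

module Defs where

open import Level using (Level; _⊔_) renaming (suc to lsuc)
open import Data.Nat using (ℕ; zero; suc; _+_; _∸_; _≤_; _<_; _≤?_)
open import Relation.Nullary using (¬_; yes; no)
open import Algebra.Bundles using (CommutativeRing)

record Field (c ℓ : Level) : Set (lsuc (c ⊔ ℓ)) where
  field
    commutativeRing : CommutativeRing c ℓ
  open CommutativeRing commutativeRing public
  field
    0≉1  : ¬ (0# ≈ 1#)
    inv  : (x : Carrier) → ¬ (x ≈ 0#) → Carrier
    inv-r : (x : Carrier) (nz : ¬ (x ≈ 0#)) → x * inv x nz ≈ 1#

module _ {c ℓ : Level} (F : Field c ℓ) where
  open Field F using (Carrier; _≈_; _*_; 0#; 1#; inv)

  Matrix : Set c
  Matrix = ℕ → ℕ → Carrier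

  LowerTriangular : Matrix → Set ℓ
  LowerTriangular A = ∀ n k → n < k → A n k ≈ 0#

  prodUpTo : ℕ → (ℕ → Carrier) → Carrier
  prodUpTo zero    f = 1#
  prodUpTo (suc N) f = prodUpTo N f * f N

  -- the SDR_m condition, for all n k ≥ 0, 2 ≤ p ≤ m - 1, 0 ≤ r ≤ p - 1
  -- products  ∏_{i=0}^{r}  are  prodUpTo (suc r), ∏_{i=0}^{p-r-1} are prodUpTo (p ∸ r)
  SDR : ℕ → Matrix → Set ℓ
  SDR m A = ∀ n k p r → 2 ≤ p → p < m → r < p →
      (prodUpTo (suc r) (λ i → A (n + i) (k + (r ∸ i)))
         * prodUpTo (p ∸ r) (λ i → A (n + p ∸ i) (k + r + i + 1)))
    ≈ (prodUpTo (suc r) (λ i → A (n + p ∸ i) (k + (p ∸ r) + i))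
         * prodUpTo (p ∸ r) (λ i → A (n + i) (k + ((p ∸ r ∸ 1) ∸ i))))

  hadamard : Matrix → Matrix → Matrix
  hadamard A B n k = A n k * B n k

  hadamardInv : (A : Matrix) → (∀ n k → k ≤ n → ¬ (A n k ≈ 0#)) → Matrix
  hadamardInv A nz n k with k ≤? n
  ... | yes k≤n = inv (A n k) (nz n k k≤n)
  ... | no  _   = 0#

module Submission where

-- Every SDR condition is an identity between two products of entries of the
-- matrix.  Products of entries of A ∘ B factor as products over A times
-- products over B, so the identities for A and B multiply to the one for
-- A ∘ B, and SDR_{m+i} ⊆ SDR_m.  For the Hadamard inverse, call b a
-- pseudo-inverse of a when either a ≉ 0 and b a ≈ 1, or a ≈ 0 ≈ b.
-- Pseudo-inverses are unique and multiplicative, so both sides of an identity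
-- for A' are the pseudo-inverses of the equal sides of the identity for A.

open import Defs
open import Level using (Level)
open import Data.Nat using (ℕ; zero; suc; _+_; _∸_; _≤_; _≤?_)
open import Data.Nat.Properties using (<-≤-trans; m≤m+n; ≰⇒>)
open import Data.Product using (_×_; _,_)
open import Data.Sum using (_⊎_; inj₁; inj₂)
open import Data.Empty using (⊥-elim)
open import Relation.Nullary using (¬_; yes; no)
import Algebra.Properties.CommutativeSemigroup as CommutativeSemigroupProperties
import Relation.Binary.Reasoning.Setoid as SetoidReasoning

module _ {c ℓ : Level} (F : Field c ℓ) where
  open Field F hiding (_+_)
  open CommutativeSemigroupProperties *-commutativeSemigroup using (interchange)
  open SetoidReasoning setoid

  SDR-mono : ∀ {m m′} (A : Matrix F) → m ≤ m′ → SDR F m′ A → SDR F m A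
  SDR-mono A m≤m′ sdr n k p r 2≤p p<m r<p = sdr n k p r 2≤p (<-≤-trans p<m m≤m′) r<p

  prodUpTo-*-hom : ∀ N (f g : ℕ → Carrier) →
    prodUpTo F N (λ i → f i * g i) ≈ prodUpTo F N f * prodUpTo F N g
  prodUpTo-*-hom zero    f g = sym (*-identityˡ 1#)
  prodUpTo-*-hom (suc N) f g = begin
    prodUpTo F N (λ i → f i * g i) * (f N * g N)
      ≈⟨ *-cong (prodUpTo-*-hom N f g) refl ⟩
    (prodUpTo F N f * prodUpTo F N g) * (f N * g N)
      ≈⟨ interchange _ _ _ _ ⟩
    (prodUpTo F N f * f N) * (prodUpTo F N g * g N) ∎

  *-interchange-cong : ∀ {x₁ x₂ y₁ y₂ u₁ u₂ v₁ v₂} →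
    x₁ * x₂ ≈ y₁ * y₂ → u₁ * u₂ ≈ v₁ * v₂ →
    (x₁ * u₁) * (x₂ * u₂) ≈ (y₁ * v₁) * (y₂ * v₂)
  *-interchange-cong {x₁} {x₂} {y₁} {y₂} {u₁} {u₂} {v₁} {v₂} x≈y u≈v = begin
    (x₁ * u₁) * (x₂ * u₂) ≈⟨ interchange x₁ u₁ x₂ u₂ ⟩
    (x₁ * x₂) * (u₁ * u₂) ≈⟨ *-cong x≈y u≈v ⟩
    (y₁ * y₂) * (v₁ * v₂) ≈⟨ interchange y₁ y₂ v₁ v₂ ⟩
    (y₁ * v₁) * (y₂ * v₂) ∎

  SDR-hadamard : ∀ {m} (A B : Matrix F) → SDR F m A → SDR F m B →
    SDR F m (hadamard F A B)
  SDR-hadamard A B sdrA sdrB n k p r 2≤p p<m r<p =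
    trans (*-cong (prodUpTo-*-hom (suc r) _ _) (prodUpTo-*-hom (p ∸ r) _ _))
      (trans (*-interchange-cong (sdrA n k p r 2≤p p<m r<p) (sdrB n k p r 2≤p p<m r<p))
        (sym (*-cong (prodUpTo-*-hom (suc r) _ _) (prodUpTo-*-hom (p ∸ r) _ _))))

  PseudoInverse : Carrier → Carrier → Set ℓ
  PseudoInverse a b = (¬ (a ≈ 0#) × b * a ≈ 1#) ⊎ (a ≈ 0# × b ≈ 0#)

  *-nonzero : ∀ {a b} → ¬ (a ≈ 0#) → ¬ (b ≈ 0#) → ¬ (a * b ≈ 0#)
  *-nonzero {a} {b} a≉0 b≉0 ab≈0 = b≉0 (begin
    b                   ≈⟨ sym (*-identityˡ b) ⟩
    1# * b              ≈⟨ *-cong (sym (trans (*-comm _ _) (inv-r a a≉0))) refl ⟩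
    (inv a a≉0 * a) * b ≈⟨ *-assoc _ _ _ ⟩
    inv a a≉0 * (a * b) ≈⟨ *-cong refl ab≈0 ⟩
    inv a a≉0 * 0#      ≈⟨ zeroʳ _ ⟩
    0#                  ∎)

  pseudoInverse-1 : PseudoInverse 1# 1#
  pseudoInverse-1 = inj₁ ((λ 1≈0 → 0≉1 (sym 1≈0)) , *-identityˡ 1#)

  pseudoInverse-* : ∀ {a b a′ b′} → PseudoInverse a b → PseudoInverse a′ b′ →
    PseudoInverse (a * a′) (b * b′)
  pseudoInverse-* {a} {b} {a′} {b′} (inj₁ (a≉0 , ba≈1)) (inj₁ (a′≉0 , b′a′≈1)) =
    inj₁ (*-nonzero a≉0 a′≉0 , (begin
      (b * b′) * (a * a′) ≈⟨ interchange b b′ a a′ ⟩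
      (b * a) * (b′ * a′) ≈⟨ *-cong ba≈1 b′a′≈1 ⟩
      1# * 1#             ≈⟨ *-identityˡ 1# ⟩
      1#                  ∎))
  pseudoInverse-* (inj₁ _) (inj₂ (a′≈0 , b′≈0)) =
    inj₂ (trans (*-cong refl a′≈0) (zeroʳ _) , trans (*-cong refl b′≈0) (zeroʳ _))
  pseudoInverse-* (inj₂ (a≈0 , b≈0)) _ =
    inj₂ (trans (*-cong a≈0 refl) (zeroˡ _) , trans (*-cong b≈0 refl) (zeroˡ _))

  pseudoInverse-unique : ∀ {a b a′ b′} → PseudoInverse a b → PseudoInverse a′ b′ →
    a ≈ a′ → b ≈ b′
  pseudoInverse-unique {a} {b} {a′} {b′} (inj₁ (_ , ba≈1)) (inj₁ (_ , b′a′≈1)) a≈a′ = begin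
    b             ≈⟨ sym (*-identityʳ b) ⟩
    b * 1#        ≈⟨ *-cong refl (sym b′a′≈1) ⟩
    b * (b′ * a′) ≈⟨ *-cong refl (trans (*-cong refl (sym a≈a′)) (*-comm b′ a)) ⟩
    b * (a * b′)  ≈⟨ sym (*-assoc b a b′) ⟩
    (b * a) * b′  ≈⟨ *-cong ba≈1 refl ⟩
    1# * b′       ≈⟨ *-identityˡ b′ ⟩
    b′            ∎
  pseudoInverse-unique (inj₁ (a≉0 , _)) (inj₂ (a′≈0 , _)) a≈a′ = ⊥-elim (a≉0 (trans a≈a′ a′≈0))
  pseudoInverse-unique (inj₂ (a≈0 , _)) (inj₁ (a′≉0 , _)) a≈a′ = ⊥-elim (a′≉0 (trans (sym a≈a′) a≈0))
  pseudoInverse-unique (inj₂ (_ , b≈0)) (inj₂ (_ , b′≈0)) _ = trans b≈0 (sym b′≈0)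

  pseudoInverse-prodUpTo : ∀ N {f g : ℕ → Carrier} → (∀ i → PseudoInverse (f i) (g i)) →
    PseudoInverse (prodUpTo F N f) (prodUpTo F N g)
  pseudoInverse-prodUpTo zero    _   = pseudoInverse-1
  pseudoInverse-prodUpTo (suc N) f⁺g = pseudoInverse-* (pseudoInverse-prodUpTo N f⁺g) (f⁺g N)

  SDR-pseudoInverse : ∀ {m} (A A′ : Matrix F) →
    (∀ n k → PseudoInverse (A n k) (A′ n k)) → SDR F m A → SDR F m A′
  SDR-pseudoInverse A A′ A⁺A′ sdrA n k p r 2≤p p<m r<p =
    pseudoInverse-unique
      (side (λ j → n + j) (λ j → k + (r ∸ j)) (λ j → n + p ∸ j) (λ j → k + r + j + 1))
      (side (λ j → n + p ∸ j) (λ j → k + (p ∸ r) + j) (λ j → n + j) (λ j → k + ((p ∸ r ∸ 1) ∸ j)))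
      (sdrA n k p r 2≤p p<m r<p)
    where
    side : ∀ (row₁ col₁ row₂ col₂ : ℕ → ℕ) →
      PseudoInverse
        (prodUpTo F (suc r) (λ j → A (row₁ j) (col₁ j)) * prodUpTo F (p ∸ r) (λ j → A (row₂ j) (col₂ j)))
        (prodUpTo F (suc r) (λ j → A′ (row₁ j) (col₁ j)) * prodUpTo F (p ∸ r) (λ j → A′ (row₂ j) (col₂ j)))
    side _ _ _ _ = pseudoInverse-*
      (pseudoInverse-prodUpTo (suc r) (λ _ → A⁺A′ _ _))
      (pseudoInverse-prodUpTo (p ∸ r) (λ _ → A⁺A′ _ _))

  -- Above the diagonal hadamardInv is 0, so lower triangularity of A is what
  -- makes it a pseudo-inverse there as well.
  hadamardInv-pseudoInverse : (A : Matrix F) → LowerTriangular F A →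
    (nz : ∀ n k → k ≤ n → ¬ (A n k ≈ 0#)) → ∀ n k → PseudoInverse (A n k) (hadamardInv F A nz n k)
  hadamardInv-pseudoInverse A lower nz n k with k ≤? n
  ... | yes k≤n = inj₁ (nz n k k≤n , trans (*-comm _ _) (inv-r _ _))
  ... | no  k≰n = inj₂ (lower n k (≰⇒> k≰n) , refl)

lemma2p1 : {c ℓ : Level} (F : Field c ℓ) (m i : ℕ) → 3 ≤ m →
    (A B : Matrix F) → LowerTriangular F A → LowerTriangular F B →
    SDR F m A → SDR F (m + i) B →
    SDR F m (hadamard F A B)
      × ((nz : ∀ n k → k ≤ n → ¬ (Field._≈_ F (A n k) (Field.0# F))) →
           SDR F m (hadamardInv F A nz))
lemma2p1 F m i _ A B lowerA _ sdrA sdrB =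
  SDR-hadamard F A B sdrA (SDR-mono F B (m≤m+n m i) sdrB) ,
  λ nz → SDR-pseudoInverse F A (hadamardInv F A nz) (hadamardInv-pseudoInverse F A lowerA nz) sdrA
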